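{- Let $a$ be an odd positive integer and let $m\ge 0$ be an integer. Then for every positive integer $n$, $$t(a,a,2a,8m+4;n)=\frac23\Big(N\big(a,a,a,4m+2;\,4n+4m+2a+2\big)-N\big(a,a,a,4m+2;\,n+m+\tfrac{a+1}2\big)\Big)$$ $$=\frac23\Big(N\big(a,a,2a,8m+4;\,8n+8m+4a+4\big)-N\big(a,a,2a,8m+4;\,2n+2m+a+1\big)\Big).$$
   Context: For positive integers $a,b,c,d$ and an integer $n\ge 0$, $N(a,b,c,d;n)$ denotes the number of $(x,y,z,w)\in\mathbb Z^4$ with $n=ax^2+by^2+cz^2+dw^2$, and $t(a,b,c,d;n)$ denotes the number of $(x,y,z,w)\in\mathbb Z^4$ with $n=a\frac{x(x-1)}2+b\frac{y(y-1)}2+c\frac{z(z-1)}2+d\frac{w(w-1)}2$. -}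

module Defs where

open import Data.Nat using (ℕ; zero; suc; _+_; _*_; _/_; _≟_)
open import Data.Integer as ℤ using (ℤ; +_; ∣_∣)
open import Data.List using (List; []; _∷_; map; upTo; length; filter; concatMap)
open import Data.Product using (_×_; _,_)

range : ℕ → List ℤ
range B = map (λ i → (+ i) ℤ.- (+ B)) (upTo (suc (B + B)))

box : ℕ → List (ℤ × ℤ × ℤ × ℤ)
box B = concatMap (λ x → concatMap (λ y → concatMap (λ z → map (λ w → (x , y , z , w))
          (range B)) (range B)) (range B)) (range B)

sq : ℤ → ℕ
sq x = ∣ x ℤ.* x ∣

-- x(x-1)/2 as a natural number (x(x-1) is always a nonnegative even integer)
tri : ℤ → ℕ
tri x = ∣ x ℤ.* (x ℤ.- + 1) ∣ / 2

-- For positive a,b,c,d every solution satisfies |x|,|y|,|z|,|w| ≤ n ≤ n+1,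
-- so enumerating the box [-(n+1), n+1]^4 counts all of ℤ^4.
N : ℕ → ℕ → ℕ → ℕ → ℕ → ℕ
N a b c d n = length (filter (λ { (x , y , z , w) →
  a * sq x + b * sq y + c * sq z + d * sq w ≟ n }) (box (suc n)))

-- t(a,b,c,d;n): number of (x,y,z,w) ∈ ℤ^4 with
-- n = a x(x-1)/2 + b y(y-1)/2 + c z(z-1)/2 + d w(w-1)/2.
-- For positive coefficients every solution satisfies |x|,… ≤ n+1.
t : ℕ → ℕ → ℕ → ℕ → ℕ → ℕ
t a b c d n = length (filter (λ { (x , y , z , w) →
  a * tri x + b * tri y + c * tri z + d * tri w ≟ n }) (box (suc n)))

module Submission where

open import Defs

-- Write F = a x² + a y² + 2a z² + (8m+4) w² and sort the solutions of F(v) = 8K by the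
-- parities of x, y, z, w.  A congruence analysis modulo 8 shows there are only three kinds:
--   * all even: halving is a bijection onto the solutions of F = 2K;
--   * all odd: x ↦ (x+1)/2 is a bijection onto the solutions of
--     a·T(x) + a·T(y) + 2a·T(z) + (8m+4)·T(w) = n with T(x) = x(x−1)/2, which t counts;
--   * mixed (x, y, z even, w odd): the map φ (x,y,z,w) ↦ (u+z, u−z, v, w) with
--     u = (x+y)/2, v = (x−y)/2 identifies them with the all-odd solutions having u odd, and
--     y ↦ −y shows that these are exactly half of the all-odd solutions.
-- Hence N(8K) = N(2K) + t + t/2, i.e. 3t = 2(N(8K) − N(2K)).  Finally the rotation
-- (x, y) ↦ (x+y, x−y) gives N(a,a,a,4m+2; L) = N(a,a,2a,8m+4; 2L).

module Proof where

  open import Data.Nat as ℕ using (ℕ; zero; suc; z≤n; s≤s; _≤_; _<_)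
  import Data.Nat.Properties as ℕP
  open import Data.Nat.DivMod using (m≡m%n+[m/n]*n; m%n<n; m*n/n≡m)
  import Data.Nat.Tactic.RingSolver as ℕ-Solver
  open import Data.Integer as ℤ using (ℤ; +_; -[1+_]; _+_; _*_; _-_; -_; ∣_∣)
  import Data.Integer.Properties as ℤP
  open import Data.Integer.Tactic.RingSolver using (solve-∀)
  open import Algebra.Properties.AbelianGroup ℤP.+-0-abelianGroup using (∙-cancelʳ)
  open import Data.List using (List; []; _∷_; _++_; [_]; length; filter; map; concatMap; cartesianProduct; upTo)
  open import Data.List.Properties using (length-++; filter-≐; map-++; map-∘; map-id; concatMap-cong)
  open import Data.List.Membership.Propositional using (_∈_)
  open import Data.List.Membership.Propositional.Properties
    using (∈-filter⁺; ∈-filter⁻; ∈-∃++; ∈-map⁺; ∈-upTo⁺; ∈-cartesianProduct⁺)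
  open import Data.List.Relation.Unary.Any using (here; there)
  import Data.List.Relation.Unary.All as All
  open import Data.List.Relation.Unary.AllPairs using (_∷_)
  open import Data.List.Relation.Unary.Unique.Propositional using (Unique)
  import Data.List.Relation.Unary.Unique.Propositional.Properties as Unique
  open import Data.Product using (_×_; _,_; ∃; proj₁; proj₂)
  open import Data.Sum using (_⊎_; inj₁; inj₂)
  open import Data.Empty using (⊥; ⊥-elim)
  open import Relation.Nullary using (¬_; yes; no; contradiction)
  open import Relation.Nullary.Decidable using (_×-dec_)
  open import Relation.Unary using (Pred; Decidable; _≐_; _∩_; ∁)
  open import Relation.Unary.Properties using (_∩?_; ∁?)
  open import Level using (0ℓ)
  open import Relation.Binary.PropositionalEquality hiding ([_])
  open ≡-Reasoning

  module _ {A : Set} where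

    count : {P : Pred A 0ℓ} → Decidable P → List A → ℕ
    count P? xs = length (filter P? xs)

    count-≐ : {P Q : Pred A 0ℓ} (P? : Decidable P) (Q? : Decidable Q) → P ≐ Q →
      ∀ xs → count P? xs ≡ count Q? xs
    count-≐ P? Q? P≐Q xs = cong length (filter-≐ P? Q? P≐Q xs)

    count-split : {P C : Pred A 0ℓ} (P? : Decidable P) (C? : Decidable C) → ∀ xs →
      count P? xs ≡ count (P? ∩? C?) xs ℕ.+ count (P? ∩? ∁? C?) xs
    count-split P? C? [] = refl
    count-split P? C? (x ∷ xs) with P? x | C? x
    ... | yes _ | yes _ = cong suc (count-split P? C? xs)
    ... | yes _ | no _  = trans (cong suc (count-split P? C? xs)) (sym (ℕP.+-suc _ _))
    ... | no _  | yes _ = count-split P? C? xs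
    ... | no _  | no _  = count-split P? C? xs

    ∈-delete : ∀ {z y : A} (us ws : List A) → z ∈ us ++ y ∷ ws → z ≢ y → z ∈ us ++ ws
    ∈-delete []       ws (here z≡y) z≢y = ⊥-elim (z≢y z≡y)
    ∈-delete []       ws (there z∈) z≢y = z∈
    ∈-delete (u ∷ us) ws (here z≡u) z≢y = here z≡u
    ∈-delete (u ∷ us) ws (there z∈) z≢y = there (∈-delete us ws z∈ z≢y)

    injection-length≤ : ∀ (f : A → A) L L' → Unique L → (∀ {v} → v ∈ L → f v ∈ L') →
      (∀ {v w} → v ∈ L → w ∈ L → f v ≡ f w → v ≡ w) → length L ≤ length L'
    injection-length≤ f []      L' _              _   _   = z≤n
    injection-length≤ f (v ∷ L) L' (v∉L ∷ uniqL) maps inj with ∈-∃++ (maps (here refl))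
    ... | us , ws , refl = subst (suc (length L) ≤_) (sym length-removed)
            (s≤s (injection-length≤ f L (us ++ ws) uniqL maps′ inj′))
      where
      length-removed : length (us ++ [ f v ] ++ ws) ≡ suc (length (us ++ ws))
      length-removed = trans (length-++ us)
        (trans (ℕP.+-suc (length us) (length ws)) (cong suc (sym (length-++ us))))
      maps′ : ∀ {w} → w ∈ L → f w ∈ us ++ ws
      maps′ w∈L = ∈-delete us ws (maps (there w∈L))
        (λ fw≡fv → All.lookup v∉L w∈L (inj (here refl) (there w∈L) (sym fw≡fv)))
      inj′ : ∀ {a b} → a ∈ L → b ∈ L → f a ≡ f b → a ≡ b
      inj′ a∈L b∈L = inj (there a∈L) (there b∈L)

    count-injection : {P Q : Pred A 0ℓ} (P? : Decidable P) (Q? : Decidable Q) (xs ys : List A) →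
      Unique xs → (f : A → A) → (∀ v → P v → Q (f v)) →
      (∀ v w → P v → P w → f v ≡ f w → v ≡ w) → (∀ w → Q w → w ∈ ys) → count P? xs ≤ count Q? ys
    count-injection P? Q? xs ys uniq f PQ inj complete =
      injection-length≤ f (filter P? xs) (filter Q? ys) (Unique.filter⁺ P? uniq)
        (λ v∈ → let Qfv = PQ _ (proj₂ (∈-filter⁻ P? {xs = xs} v∈)) in
                ∈-filter⁺ Q? {xs = ys} (complete _ Qfv) Qfv)
        (λ v∈ w∈ → inj _ _ (proj₂ (∈-filter⁻ P? {xs = xs} v∈)) (proj₂ (∈-filter⁻ P? {xs = xs} w∈)))

    count-bijection : {P Q : Pred A 0ℓ} (P? : Decidable P) (Q? : Decidable Q) (xs ys : List A) →
      Unique xs → Unique ys → (f g : A → A) → (∀ v → P v → Q (f v)) → (∀ w → Q w → P (g w)) →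
      (∀ v → P v → g (f v) ≡ v) → (∀ w → Q w → f (g w) ≡ w) →
      (∀ v → P v → v ∈ xs) → (∀ w → Q w → w ∈ ys) → count P? xs ≡ count Q? ys
    count-bijection P? Q? xs ys uxs uys f g PQ QP gf fg Pxs Qys = ℕP.≤-antisym
      (count-injection P? Q? xs ys uxs f PQ
        (λ v w Pv Pw fv≡fw → trans (sym (gf v Pv)) (trans (cong g fv≡fw) (gf w Pw))) Qys)
      (count-injection Q? P? ys xs uys g QP
        (λ v w Qv Qw gv≡gw → trans (sym (fg v Qv)) (trans (cong f gv≡gw) (fg w Qw))) Pxs)

  half : ℤ → ℤ
  half (+ n)    = + (n ℕ./ 2)
  half -[1+ n ] = -[1+ n ℕ./ 2 ]

  parity : ℤ → ℕ
  parity (+ n)    = n ℕ.% 2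
  parity -[1+ n ] = 1 ℕ.∸ n ℕ.% 2

  Even Odd : ℤ → Set
  Even x = parity x ≡ 0
  Odd x  = parity x ≡ 1

  bit : ∀ n → n ℕ.% 2 ≡ 0 ⊎ n ℕ.% 2 ≡ 1
  bit n with n ℕ.% 2 | m%n<n n 2
  ... | 0 | _ = inj₁ refl
  ... | 1 | _ = inj₂ refl
  ... | suc (suc _) | s≤s (s≤s ())

  parity-cases : ∀ x → Even x ⊎ Odd x
  parity-cases (+ n) = bit n
  parity-cases -[1+ n ] with bit n
  ... | inj₁ r≡0 = inj₂ (cong (1 ℕ.∸_) r≡0)
  ... | inj₂ r≡1 = inj₁ (cong (1 ℕ.∸_) r≡1)

  even-not-odd : ∀ x → Even x → Odd x → ⊥
  even-not-odd x e o with () ← trans (sym e) o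

  half-parity : ∀ x → x ≡ + 2 * half x + + parity x
  half-parity (+ n) = begin
    + n                                ≡⟨ cong +_ (m≡m%n+[m/n]*n n 2) ⟩
    + (n ℕ.% 2 ℕ.+ n ℕ./ 2 ℕ.* 2)      ≡⟨ ℤP.pos-+ (n ℕ.% 2) _ ⟩
    + (n ℕ.% 2) + + (n ℕ./ 2 ℕ.* 2)    ≡⟨ cong (λ k → + (n ℕ.% 2) + k) (ℤP.pos-* (n ℕ./ 2) 2) ⟩
    + (n ℕ.% 2) + + (n ℕ./ 2) * + 2    ≡⟨ swap (+ (n ℕ.% 2)) (+ (n ℕ./ 2)) ⟩
    + 2 * + (n ℕ./ 2) + + (n ℕ.% 2)    ∎
    where
    swap : ∀ r h → r + h * + 2 ≡ + 2 * h + r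
    swap = solve-∀
  half-parity -[1+ n ] = trans (cong -[1+_] (m≡m%n+[m/n]*n n 2)) (negative (n ℕ./ 2) (bit n))
    where
    negative : ∀ h {r} → r ≡ 0 ⊎ r ≡ 1 → -[1+ r ℕ.+ h ℕ.* 2 ] ≡ + 2 * -[1+ h ] + + (1 ℕ.∸ r)
    negative h (inj₁ refl) = trans (cong (λ k → - (+ 1 + k)) (ℤP.pos-* h 2)) (identity (+ h))
      where
      identity : ∀ h → - (+ 1 + h * + 2) ≡ + 2 * - (+ 1 + h) + + 1
      identity = solve-∀
    negative h (inj₂ refl) = trans (cong (λ k → - (+ 1 + (+ 1 + k))) (ℤP.pos-* h 2)) (identity (+ h))
      where
      identity : ∀ h → - (+ 1 + (+ 1 + h * + 2)) ≡ + 2 * - (+ 1 + h) + + 0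
      identity = solve-∀

  two*≢1 : ∀ z → + 2 * z ≢ + 1
  two*≢1 z eq with () ← ℕP.m*n≡1⇒m≡1 2 ∣ z ∣ (trans (sym (ℤP.abs-* (+ 2) z)) (cong ∣_∣ eq))

  odd≢even : ∀ h k → + 2 * h + + 1 ≢ + 2 * k
  odd≢even h k eq = two*≢1 (k - h) (begin
    + 2 * (k - h)            ≡⟨ difference h k ⟩
    + 2 * k - + 2 * h        ≡⟨ cong (_- + 2 * h) eq ⟨
    + 2 * h + + 1 - + 2 * h  ≡⟨ cancel h ⟩
    + 1                      ∎)
    where
    difference : ∀ h k → + 2 * (k - h) ≡ + 2 * k - + 2 * h
    difference = solve-∀
    cancel : ∀ h → + 2 * h + + 1 - + 2 * h ≡ + 1
    cancel = solve-∀

  -- The same after scaling by any nonzero c; this is the shape of all congruence obstructions below.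
  scaled-odd≢even : ∀ c .{{_ : ℤ.NonZero c}} h k → c * (+ 2 * h + + 1) ≢ c * (+ 2 * k)
  scaled-odd≢even c h k eq = odd≢even h k (ℤP.*-cancelˡ-≡ c _ _ eq)

  even-split : ∀ x → Even x → x ≡ + 2 * half x
  even-split x e = trans (half-parity x) (trans (cong (λ r → + 2 * half x + + r) e) (ℤP.+-identityʳ _))

  odd-split : ∀ x → Odd x → x ≡ + 2 * half x + + 1
  odd-split x o = trans (half-parity x) (cong (λ r → + 2 * half x + + r) o)

  even-unique : ∀ {x} k → x ≡ + 2 * k → Even x × half x ≡ k
  even-unique {x} k x≡2k with parity-cases x
  ... | inj₁ e = e , ℤP.*-cancelˡ-≡ (+ 2) (half x) k (trans (sym (even-split x e)) x≡2k)
  ... | inj₂ o = contradiction (trans (sym (odd-split x o)) x≡2k) (odd≢even (half x) k)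

  odd-unique : ∀ {x} k → x ≡ + 2 * k + + 1 → Odd x × half x ≡ k
  odd-unique {x} k x≡2k+1 with parity-cases x
  ... | inj₁ e = contradiction (trans (sym x≡2k+1) (even-split x e)) (odd≢even k (half x))
  ... | inj₂ o = o , ℤP.*-cancelˡ-≡ (+ 2) (half x) k
                        (∙-cancelʳ (+ 1) _ _ (trans (sym (odd-split x o)) x≡2k+1))

  half-double : ∀ k → half (+ 2 * k) ≡ k
  half-double k = proj₂ (even-unique k refl)

  odd+odd : ∀ x y → Odd x → Odd y → Even (x + y)
  odd+odd x y ox oy = proj₁ (even-unique (half x + half y + + 1)
    (trans (cong₂ _+_ (odd-split x ox) (odd-split y oy)) (identity (half x) (half y))))
    where
    identity : ∀ h k → (+ 2 * h + + 1) + (+ 2 * k + + 1) ≡ + 2 * (h + k + + 1)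
    identity = solve-∀

  odd-odd : ∀ x y → Odd x → Odd y → Even (x - y)
  odd-odd x y ox oy = proj₁ (even-unique (half x - half y)
    (trans (cong₂ _-_ (odd-split x ox) (odd-split y oy)) (identity (half x) (half y))))
    where
    identity : ∀ h k → (+ 2 * h + + 1) - (+ 2 * k + + 1) ≡ + 2 * (h - k)
    identity = solve-∀

  odd+even : ∀ x y → Odd x → Even y → Odd (x + y)
  odd+even x y ox ey = proj₁ (odd-unique (half x + half y)
    (trans (cong₂ _+_ (odd-split x ox) (even-split y ey)) (identity (half x) (half y))))
    where
    identity : ∀ h k → (+ 2 * h + + 1) + + 2 * k ≡ + 2 * (h + k) + + 1
    identity = solve-∀

  odd-even : ∀ x y → Odd x → Even y → Odd (x - y)
  odd-even x y ox ey = proj₁ (odd-unique (half x - half y)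
    (trans (cong₂ _-_ (odd-split x ox) (even-split y ey)) (identity (half x) (half y))))
    where
    identity : ∀ h k → (+ 2 * h + + 1) - + 2 * k ≡ + 2 * (h - k) + + 1
    identity = solve-∀

  neg-odd : ∀ x → Odd x → Odd (- x)
  neg-odd x ox = proj₁ (odd-unique (- half x - + 1) (trans (cong -_ (odd-split x ox)) (identity (half x))))
    where
    identity : ∀ h → - (+ 2 * h + + 1) ≡ + 2 * (- h - + 1) + + 1
    identity = solve-∀

  half-sum-diff : ∀ x y → parity x ≡ parity y →
    (x ≡ half (x + y) + half (x - y)) × (y ≡ half (x + y) - half (x - y))
  half-sum-diff x y same =
    trans x≡ (trans (x-identity hx hy p) (sym (cong₂ _+_ half-sum half-diff))) ,
    trans y≡ (trans (y-identity hx hy p) (sym (cong₂ _-_ half-sum half-diff)))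
    where
    hx hy p : ℤ
    hx = half x
    hy = half y
    p = + parity x
    x≡ : x ≡ + 2 * hx + p
    x≡ = half-parity x
    y≡ : y ≡ + 2 * hy + p
    y≡ = trans (half-parity y) (cong (λ r → + 2 * hy + + r) (sym same))
    sum-identity : ∀ h k p → (+ 2 * h + p) + (+ 2 * k + p) ≡ + 2 * (h + k + p)
    sum-identity = solve-∀
    diff-identity : ∀ h k p → (+ 2 * h + p) - (+ 2 * k + p) ≡ + 2 * (h - k)
    diff-identity = solve-∀
    x-identity : ∀ h k p → + 2 * h + p ≡ (h + k + p) + (h - k)
    x-identity = solve-∀
    y-identity : ∀ h k p → + 2 * k + p ≡ (h + k + p) - (h - k)
    y-identity = solve-∀
    half-sum : half (x + y) ≡ hx + hy + p
    half-sum = proj₂ (even-unique _ (trans (cong₂ _+_ x≡ y≡) (sum-identity hx hy p)))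
    half-diff : half (x - y) ≡ hx - hy
    half-diff = proj₂ (even-unique _ (trans (cong₂ _-_ x≡ y≡) (diff-identity hx hy p)))

  even-square : ∀ x → Even x → x * x ≡ + 4 * (half x * half x)
  even-square x e = trans (cong (λ u → u * u) (even-split x e)) (identity (half x))
    where
    identity : ∀ h → (+ 2 * h) * (+ 2 * h) ≡ + 4 * (h * h)
    identity = solve-∀

  pronic-even : ∀ j → ∃ λ T → (j ℕ.* suc j ≡ 2 ℕ.* T) × j ≤ T
  pronic-even zero = 0 , refl , z≤n
  pronic-even (suc j) with pronic-even j
  ... | T , j[j+1]≡2T , j≤T = T ℕ.+ suc j , step , ℕP.m≤n+m (suc j) T
    where
    expand : ∀ j → suc j ℕ.* suc (suc j) ≡ j ℕ.* suc j ℕ.+ 2 ℕ.* suc j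
    expand = ℕ-Solver.solve-∀
    step : suc j ℕ.* suc (suc j) ≡ 2 ℕ.* (T ℕ.+ suc j)
    step = trans (expand j) (trans (cong (ℕ._+ 2 ℕ.* suc j) j[j+1]≡2T) (sym (ℕP.*-distribˡ-+ 2 T (suc j))))

  pronic-form : ∀ x → ∃ λ j → (x * (x - + 1) ≡ + (j ℕ.* suc j)) × ∣ x ∣ ≤ suc j
  pronic-form (+ zero)  = 0 , refl , z≤n
  pronic-form (+ suc k) = k , trans (sym (ℤP.pos-* (suc k) k)) (cong +_ (ℕP.*-comm (suc k) k)) , ℕP.≤-refl
  pronic-form -[1+ k ]  = suc k , product , ℕP.n≤1+n (suc k)
    where
    product : -[1+ k ] * (-[1+ k ] - + 1) ≡ + (suc k ℕ.* suc (suc k))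
    product rewrite ℕP.+-identityʳ k = refl

  tri-spec : ∀ x → (+ 2 * + tri x ≡ x * (x - + 1)) × ∣ x ∣ ≤ suc (tri x)
  tri-spec x with pronic-form x
  ... | j , x[x-1]≡j[j+1] , x≤j+1 with pronic-even j
  ... | T , j[j+1]≡2T , j≤T =
    trans (cong (λ u → + 2 * + u) tri≡T)
          (trans (sym (ℤP.pos-* 2 T)) (trans (cong +_ (sym j[j+1]≡2T)) (sym x[x-1]≡j[j+1]))) ,
    ℕP.≤-trans x≤j+1 (subst (λ u → suc j ≤ suc u) (sym tri≡T) (s≤s j≤T))
    where
    tri≡T : tri x ≡ T
    tri≡T = trans (cong (λ u → ∣ u ∣ ℕ./ 2) (trans x[x-1]≡j[j+1] (cong +_ j[j+1]≡2T)))
                  (trans (cong (ℕ._/ 2) (ℕP.*-comm 2 T)) (m*n/n≡m T 2))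

  odd-square-tri : ∀ x → (+ 2 * x - + 1) * (+ 2 * x - + 1) ≡ + 8 * + tri x + + 1
  odd-square-tri x = begin
    (+ 2 * x - + 1) * (+ 2 * x - + 1)  ≡⟨ expand x ⟩
    + 4 * (x * (x - + 1)) + + 1        ≡⟨ cong (λ t → + 4 * t + + 1) (proj₁ (tri-spec x)) ⟨
    + 4 * (+ 2 * + tri x) + + 1        ≡⟨ regroup (+ tri x) ⟩
    + 8 * + tri x + + 1                ∎
    where
    expand : ∀ x → (+ 2 * x - + 1) * (+ 2 * x - + 1) ≡ + 4 * (x * (x - + 1)) + + 1
    expand = solve-∀
    regroup : ∀ t → + 4 * (+ 2 * t) + + 1 ≡ + 8 * t + + 1
    regroup = solve-∀

  odd-square : ∀ x → Odd x → ∃ λ T → x * x ≡ + 8 * T + + 1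
  odd-square x o = + tri (half x + + 1) ,
    trans (cong (λ u → u * u) (trans (odd-split x o) (shift (half x)))) (odd-square-tri (half x + + 1))
    where
    shift : ∀ h → + 2 * h + + 1 ≡ + 2 * (h + + 1) - + 1
    shift = solve-∀

  V : Set
  V = ℤ × ℤ × ℤ × ℤ

  private
    concatMap-map : ∀ {X Y W : Set} (t : X × Y → W) (xs : List X) (ys : List Y) →
      concatMap (λ x → map (λ y → t (x , y)) ys) xs ≡ map t (cartesianProduct xs ys)
    concatMap-map t [] ys = refl
    concatMap-map t (x ∷ xs) ys = trans (cong₂ _++_ (map-∘ ys) (concatMap-map t xs ys))
      (sym (map-++ t (map (x ,_) ys) (cartesianProduct xs ys)))

  box-as-product : ∀ B → box B ≡
    cartesianProduct (range B) (cartesianProduct (range B) (cartesianProduct (range B) (range B)))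
  box-as-product B =
    trans (concatMap-cong (λ x → trans (concatMap-cong (λ y → concatMap-map (λ p → (x , y , p)) r r) r)
                                        (concatMap-map (λ p → (x , p)) r r²)) r)
          (trans (concatMap-map (λ p → p) r r³) (map-id _))
    where
    r : List ℤ
    r = range B
    r² : List (ℤ × ℤ)
    r² = cartesianProduct r r
    r³ : List (ℤ × ℤ × ℤ)
    r³ = cartesianProduct r r²

  range-unique : ∀ B → Unique (range B)
  range-unique B = Unique.map⁺ (λ {i} {j} eq → ℤP.+-injective (∙-cancelʳ (- + B) (+ i) (+ j) eq)) (Unique.upTo⁺ _)

  box-unique : ∀ B → Unique (box B)
  box-unique B = subst Unique (sym (box-as-product B))
    (Unique.cartesianProduct⁺ (range-unique B)
      (Unique.cartesianProduct⁺ (range-unique B) (Unique.cartesianProduct⁺ (range-unique B) (range-unique B))))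

  range-complete : ∀ B x → ∣ x ∣ ≤ B → x ∈ range B
  range-complete B x |x|≤B with index x |x|≤B
    where
    index : ∀ x → ∣ x ∣ ≤ B → ∃ λ i → (+ i ≡ x + + B) × i < suc (B ℕ.+ B)
    index (+ k)    k≤B   = k ℕ.+ B , refl , s≤s (ℕP.+-monoˡ-≤ B k≤B)
    index -[1+ k ] 1+k≤B = B ℕ.∸ suc k , sym (ℤP.⊖-≥ 1+k≤B) ,
                           s≤s (ℕP.≤-trans (ℕP.m∸n≤m B (suc k)) (ℕP.m≤m+n B B))
  ... | i , i≡x+B , i<2B+1 = subst (_∈ range B) (trans (cong (_- + B) i≡x+B) (cancel x (+ B)))
                                   (∈-map⁺ (λ i → (+ i) - (+ B)) (∈-upTo⁺ i<2B+1))
    where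
    cancel : ∀ x b → x + b - b ≡ x
    cancel = solve-∀

  box-complete : ∀ B x y z w → ∣ x ∣ ≤ B → ∣ y ∣ ≤ B → ∣ z ∣ ≤ B → ∣ w ∣ ≤ B → (x , y , z , w) ∈ box B
  box-complete B x y z w bx by bz bw = subst ((x , y , z , w) ∈_) (sym (box-as-product B))
    (∈-cartesianProduct⁺ (range-complete B x bx)
      (∈-cartesianProduct⁺ (range-complete B y by) (∈-cartesianProduct⁺ (range-complete B z bz) (range-complete B w bw))))

  weighted : (ℤ → ℕ) → ℕ → ℕ → ℕ → ℕ → V → ℕ
  weighted f a b c d (x , y , z , w) = a ℕ.* f x ℕ.+ b ℕ.* f y ℕ.+ c ℕ.* f z ℕ.+ d ℕ.* f w

  sq-bound : ∀ x → ∣ x ∣ ≤ suc (sq x)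
  sq-bound x = ℕP.≤-trans (self≤square ∣ x ∣) (subst (_≤ suc (sq x)) (ℤP.abs-* x x) (ℕP.n≤1+n _))
    where
    self≤square : ∀ k → k ≤ k ℕ.* k
    self≤square zero    = z≤n
    self≤square (suc k) = ℕP.m≤m*n (suc k) (suc k)

  weighted-in-box : ∀ f → (∀ x → ∣ x ∣ ≤ suc (f x)) → ∀ {a b c d n} → 1 ≤ a → 1 ≤ b → 1 ≤ c → 1 ≤ d →
    ∀ v → weighted f a b c d v ≡ n → v ∈ box (suc n)
  weighted-in-box f bound {a} {b} {c} {d} {n} 1≤a 1≤b 1≤c 1≤d (x , y , z , w) refl =
    box-complete (suc n) x y z w
      (term-bound x 1≤a (ℕP.≤-trans (ℕP.m≤m+n tx ty) (ℕP.≤-trans (ℕP.m≤m+n (tx ℕ.+ ty) tz) (ℕP.m≤m+n _ tw))))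
      (term-bound y 1≤b (ℕP.≤-trans (ℕP.m≤n+m ty tx) (ℕP.≤-trans (ℕP.m≤m+n (tx ℕ.+ ty) tz) (ℕP.m≤m+n _ tw))))
      (term-bound z 1≤c (ℕP.≤-trans (ℕP.m≤n+m tz (tx ℕ.+ ty)) (ℕP.m≤m+n _ tw)))
      (term-bound w 1≤d (ℕP.m≤n+m tw _))
    where
    tx ty tz tw : ℕ
    tx = a ℕ.* f x
    ty = b ℕ.* f y
    tz = c ℕ.* f z
    tw = d ℕ.* f w
    term-bound : ∀ u {e} → 1 ≤ e → e ℕ.* f u ≤ n → ∣ u ∣ ≤ suc n
    term-bound u {suc e} _ eu≤n = ℕP.≤-trans (bound u) (s≤s (ℕP.≤-trans (ℕP.m≤n*m (f u) (suc e)) eu≤n))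

  form : (ℤ → ℤ) → ℤ → ℤ → ℤ → ℤ → V → ℤ
  form g a b c d (x , y , z , w) = a * g x + b * g y + c * g z + d * g w

  square : ℤ → ℤ
  square x = x * x

  weighted-as-form : ∀ f a b c d v →
    + weighted f a b c d v ≡ form (λ x → + f x) (+ a) (+ b) (+ c) (+ d) v
  weighted-as-form f a b c d (x , y , z , w) =
    trans (ℤP.pos-+ (a ℕ.* f x ℕ.+ b ℕ.* f y ℕ.+ c ℕ.* f z) (d ℕ.* f w))
    (cong₂ _+_ (trans (ℤP.pos-+ (a ℕ.* f x ℕ.+ b ℕ.* f y) (c ℕ.* f z))
      (cong₂ _+_ (trans (ℤP.pos-+ (a ℕ.* f x) (b ℕ.* f y))
        (cong₂ _+_ (ℤP.pos-* a (f x)) (ℤP.pos-* b (f y)))) (ℤP.pos-* c (f z)))) (ℤP.pos-* d (f w)))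

  sq-as-square : ∀ x → + sq x ≡ square x
  sq-as-square (+ n)    = trans (cong (λ u → + ∣ u ∣) (sym (ℤP.pos-* n n))) (ℤP.pos-* n n)
  sq-as-square -[1+ n ] = refl

  F : ℤ → ℤ → V → ℤ
  F a d = form square a a (+ 2 * a) d

  G : ℤ → ℤ → V → ℤ
  G a e = form square a a a e

  T : ℤ → ℤ → V → ℤ
  T a d = form (λ x → + tri x) a a (+ 2 * a) d

  level? : (Q : V → ℤ) (c : ℤ) → Decidable (λ v → Q v ≡ c)
  level? Q c v = Q v ℤ.≟ c

  form-cong : ∀ {g h : ℤ → ℤ} {a b c d a′ b′ c′ d′} → (∀ x → g x ≡ h x) →
    a ≡ a′ → b ≡ b′ → c ≡ c′ → d ≡ d′ → ∀ v → form g a b c d v ≡ form h a′ b′ c′ d′ v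
  form-cong g≗h refl refl refl refl (x , y , z , w) rewrite g≗h x | g≗h y | g≗h z | g≗h w = refl

  module Reading (f : ℤ → ℕ) (g : ℤ → ℤ) (f≗g : ∀ x → + f x ≡ g x) (bound : ∀ x → ∣ x ∣ ≤ suc (f x))
                 {a b c d : ℕ} {a′ b′ c′ d′ : ℤ} (a≡ : + a ≡ a′) (b≡ : + b ≡ b′) (c≡ : + c ≡ c′) (d≡ : + d ≡ d′)
                 (1≤a : 1 ≤ a) (1≤b : 1 ≤ b) (1≤c : 1 ≤ c) (1≤d : 1 ≤ d) where

    as-form : ∀ v → + weighted f a b c d v ≡ form g a′ b′ c′ d′ v
    as-form v = trans (weighted-as-form f a b c d v) (form-cong f≗g a≡ b≡ c≡ d≡ v)

    count-as-level : ∀ n → count (λ v → weighted f a b c d v ℕ.≟ n) (box (suc n))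
                         ≡ count (level? (form g a′ b′ c′ d′) (+ n)) (box (suc n))
    count-as-level n = count-≐ (λ v → weighted f a b c d v ℕ.≟ n) (level? (form g a′ b′ c′ d′) (+ n))
      ((λ {v} eq → trans (sym (as-form v)) (cong +_ eq)) , (λ {v} eq → ℤP.+-injective (trans (as-form v) eq)))
      (box (suc n))

    level-in-box : ∀ n v → form g a′ b′ c′ d′ v ≡ + n → v ∈ box (suc n)
    level-in-box n v eq = weighted-in-box f bound 1≤a 1≤b 1≤c 1≤d v (ℤP.+-injective (trans (as-form v) eq))

  F-squares : ∀ a d x y z w {X Y Z W} → x * x ≡ X → y * y ≡ Y → z * z ≡ Z → w * w ≡ W →
    F a d (x , y , z , w) ≡ a * X + a * Y + + 2 * a * Z + d * W
  F-squares a d x y z w refl refl refl refl = refl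

  A : ℤ → ℤ
  A α = + 2 * α + + 1

  E : ℤ → ℤ
  E μ = + 4 * μ + + 2

  private
    even-odd-witness : ℤ → ℤ → V → ℤ
    even-odd-witness α e (x , y , z , w) =
      + 2 * (+ 2 * α + + 1) * (half x * half x) + + 2 * (+ 2 * α + + 1) * (half y * half y + half y)
      + (+ 2 * α + + 1) * (z * z) + e * (w * w) + α

    even-odd-value : ∀ α e x y z w → Even x → Odd y →
      F (A α) (+ 2 * e) (x , y , z , w) ≡ + 2 * even-odd-witness α e (x , y , z , w) + + 1
    even-odd-value α e x y z w ex oy =
      trans (F-squares (A α) (+ 2 * e) x y z w (even-square x ex) (cong square (odd-split y oy)) refl refl)
            (identity α e (half x) (half y) (z * z) (w * w))
      where
      identity : ∀ α e h k Z W →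
        (+ 2 * α + + 1) * (+ 4 * (h * h)) + (+ 2 * α + + 1) * ((+ 2 * k + + 1) * (+ 2 * k + + 1))
          + + 2 * (+ 2 * α + + 1) * Z + + 2 * e * W
        ≡ + 2 * (+ 2 * (+ 2 * α + + 1) * (h * h) + + 2 * (+ 2 * α + + 1) * (k * k + k)
                 + (+ 2 * α + + 1) * Z + e * W + α) + + 1
      identity = solve-∀

    F-swap : ∀ a d x y z w → F a d (x , y , z , w) ≡ F a d (y , x , z , w)
    F-swap a d x y z w = swap a d (x * x) (y * y) (z * z) (w * w)
      where
      swap : ∀ a d X Y Z W → a * X + a * Y + + 2 * a * Z + d * W ≡ a * Y + a * X + + 2 * a * Z + d * W
      swap = solve-∀

  same-parity-xy : ∀ α e x y z w Q → F (A α) (+ 2 * e) (x , y , z , w) ≡ + 2 * Q → parity x ≡ parity y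
  same-parity-xy α e x y z w Q eq with parity-cases x | parity-cases y
  ... | inj₁ ex | inj₁ ey = trans ex (sym ey)
  ... | inj₂ ox | inj₂ oy = trans ox (sym oy)
  ... | inj₁ ex | inj₂ oy =
    contradiction (trans (sym (even-odd-value α e x y z w ex oy)) eq)
                  (odd≢even (even-odd-witness α e (x , y , z , w)) Q)
  ... | inj₂ ox | inj₁ ey =
    contradiction (trans (sym (even-odd-value α e y x z w ey ox)) (trans (F-swap (A α) (+ 2 * e) y x z w) eq))
                  (odd≢even (even-odd-witness α e (y , x , z , w)) Q)

  AllEven AllOdd : V → Set
  AllEven (x , y , z , w) = Even x × Even y × Even z × Even w
  AllOdd  (x , y , z , w) = Odd x × Odd y × Odd z × Odd w

  all-even? : Decidable AllEven
  all-even? (x , y , z , w) = (parity x ℕ.≟ 0) ×-dec (parity y ℕ.≟ 0) ×-dec (parity z ℕ.≟ 0) ×-dec (parity w ℕ.≟ 0)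

  all-odd? : Decidable AllOdd
  all-odd? (x , y , z , w) = (parity x ℕ.≟ 1) ×-dec (parity y ℕ.≟ 1) ×-dec (parity z ℕ.≟ 1) ×-dec (parity w ℕ.≟ 1)

  -- Congruences modulo 8 for F(2α + 1, 8μ + 4).  Each obstruction writes the value of the form
  -- as c·(odd number) with c ∈ {2, 4}, which cannot equal c·(even number) (scaled-odd≢even).
  module Mod8 (α μ : ℤ) where

    S : V → ℤ
    S = F (A α) (+ 2 * E μ)

    odd-xy⇒odd-zw : ∀ x y z w K → S (x , y , z , w) ≡ + 8 * K → Odd x → Odd y → Odd z × Odd w
    odd-xy⇒odd-zw x y z w K eq ox oy
      with T₁ , x²≡ ← odd-square x ox | T₂ , y²≡ ← odd-square y oy | parity-cases z
    ... | inj₁ ez = contradiction (trans (sym (trans (F-squares (A α) (+ 2 * E μ) x y z w x²≡ y²≡ (even-square z ez) refl)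
                                    (identity α μ T₁ T₂ (half z) (w * w)))) (trans eq (eight K)))
                                  (scaled-odd≢even (+ 2) R (+ 2 * K))
      where
      R : ℤ
      R = + 4 * α * (T₁ + T₂) + α + + 2 * (T₁ + T₂) + + 2 * (+ 2 * α + + 1) * (half z * half z) + (+ 2 * μ + + 1) * (w * w)
      identity : ∀ α μ T₁ T₂ h W →
        (+ 2 * α + + 1) * (+ 8 * T₁ + + 1) + (+ 2 * α + + 1) * (+ 8 * T₂ + + 1)
          + + 2 * (+ 2 * α + + 1) * (+ 4 * (h * h)) + (+ 2 * (+ 4 * μ + + 2)) * W
        ≡ + 2 * (+ 2 * (+ 4 * α * (T₁ + T₂) + α + + 2 * (T₁ + T₂) + + 2 * (+ 2 * α + + 1) * (h * h)
                        + (+ 2 * μ + + 1) * W) + + 1)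
      identity = solve-∀
      eight : ∀ K → + 8 * K ≡ + 2 * (+ 2 * (+ 2 * K))
      eight = solve-∀
    ... | inj₂ oz with T₃ , z²≡ ← odd-square z oz | parity-cases w
    ...   | inj₂ ow = oz , ow
    ...   | inj₁ ew = contradiction (trans (sym (trans (F-squares (A α) (+ 2 * E μ) x y z w x²≡ y²≡ z²≡ (even-square w ew))
                                      (identity α μ T₁ T₂ T₃ (half w)))) (trans eq (eight K)))
                                    (scaled-odd≢even (+ 4) R K)
      where
      R : ℤ
      R = + 2 * α * (T₁ + T₂ + + 2 * T₃) + α + (T₁ + T₂ + + 2 * T₃) + (+ 4 * μ + + 2) * (half w * half w)
      identity : ∀ α μ T₁ T₂ T₃ h →
        (+ 2 * α + + 1) * (+ 8 * T₁ + + 1) + (+ 2 * α + + 1) * (+ 8 * T₂ + + 1)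
          + + 2 * (+ 2 * α + + 1) * (+ 8 * T₃ + + 1) + (+ 2 * (+ 4 * μ + + 2)) * (+ 4 * (h * h))
        ≡ + 4 * (+ 2 * (+ 2 * α * (T₁ + T₂ + + 2 * T₃) + α + (T₁ + T₂ + + 2 * T₃) + (+ 4 * μ + + 2) * (h * h)) + + 1)
      identity = solve-∀
      eight : ∀ K → + 8 * K ≡ + 4 * (+ 2 * K)
      eight = solve-∀

    even-xy⇒even-z : ∀ x y z w K → S (x , y , z , w) ≡ + 8 * K → Even x → Even y → Even z
    even-xy⇒even-z x y z w K eq ex ey with parity-cases z
    ... | inj₁ ez = ez
    ... | inj₂ oz with T₃ , z²≡ ← odd-square z oz =
      contradiction (trans (sym (trans (F-squares (A α) (+ 2 * E μ) x y z w (even-square x ex) (even-square y ey) z²≡ refl)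
                      (identity α μ (half x) (half y) T₃ (w * w)))) (trans eq (eight K)))
                    (scaled-odd≢even (+ 2) R (+ 2 * K))
      where
      R : ℤ
      R = (+ 2 * α + + 1) * (half x * half x + half y * half y) + + 4 * (+ 2 * α + + 1) * T₃ + α + (+ 2 * μ + + 1) * (w * w)
      identity : ∀ α μ h k T W →
        (+ 2 * α + + 1) * (+ 4 * (h * h)) + (+ 2 * α + + 1) * (+ 4 * (k * k))
          + + 2 * (+ 2 * α + + 1) * (+ 8 * T + + 1) + (+ 2 * (+ 4 * μ + + 2)) * W
        ≡ + 2 * (+ 2 * ((+ 2 * α + + 1) * (h * h + k * k) + + 4 * (+ 2 * α + + 1) * T + α + (+ 2 * μ + + 1) * W) + + 1)
      identity = solve-∀
      eight : ∀ K → + 8 * K ≡ + 2 * (+ 2 * (+ 2 * K))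
      eight = solve-∀

    odd-w⇒odd-half-sum : ∀ x y z w K → S (x , y , z , w) ≡ + 8 * K → Even x → Even y → Even z → Odd w →
      Odd (half x + half y)
    odd-w⇒odd-half-sum x y z w K eq ex ey ez ow with parity-cases (half x + half y)
    ... | inj₂ o = o
    ... | inj₁ e with T₄ , w²≡ ← odd-square w ow =
      contradiction (trans (sym (trans (F-squares (A α) (+ 2 * E μ) x y z w (even-square x ex) y²≡ (even-square z ez) w²≡)
                      (identity α μ p s (half z) T₄))) (trans eq (eight K)))
                    (scaled-odd≢even (+ 4) R K)
      where
      p s R : ℤ
      p = half x
      s = half (half x + half y)
      R = (+ 2 * α + + 1) * (p * p - + 2 * s * p + + 2 * s * s) + (+ 2 * α + + 1) * (half z * half z) + (+ 2 * (+ 4 * μ + + 2)) * T₄ + μ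
      -- y/2 = 2s - x/2
      y²≡ : y * y ≡ + 4 * ((+ 2 * s - p) * (+ 2 * s - p))
      y²≡ = trans (even-square y ey)
        (cong (λ u → + 4 * (u * u)) (trans (solve-y p (half y)) (cong (_- p) (even-split (half x + half y) e))))
        where
        solve-y : ∀ p q → q ≡ (p + q) - p
        solve-y = solve-∀
      identity : ∀ α μ p s r T →
        (+ 2 * α + + 1) * (+ 4 * (p * p)) + (+ 2 * α + + 1) * (+ 4 * ((+ 2 * s - p) * (+ 2 * s - p)))
          + + 2 * (+ 2 * α + + 1) * (+ 4 * (r * r)) + (+ 2 * (+ 4 * μ + + 2)) * (+ 8 * T + + 1)
        ≡ + 4 * (+ 2 * ((+ 2 * α + + 1) * (p * p - + 2 * s * p + + 2 * s * s) + (+ 2 * α + + 1) * (r * r)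
                        + (+ 2 * (+ 4 * μ + + 2)) * T + μ) + + 1)
      identity = solve-∀
      eight : ∀ K → + 8 * K ≡ + 4 * (+ 2 * K)
      eight = solve-∀

    mixed-shape : ∀ x y z w K → S (x , y , z , w) ≡ + 8 * K →
      ¬ AllEven (x , y , z , w) → ¬ AllOdd (x , y , z , w) →
      Even x × Even y × Even z × Odd w × Odd (half x + half y)
    mixed-shape x y z w K eq not-even not-odd
      with same-parity-xy α (E μ) x y z w (+ 4 * K) (trans eq (eight K)) | parity-cases x
      where
      eight : ∀ K → + 8 * K ≡ + 2 * (+ 4 * K)
      eight = solve-∀
    ... | px≡py | inj₂ ox = contradiction (ox , oy , odd-xy⇒odd-zw x y z w K eq ox oy) not-odd
      where
      oy : Odd y
      oy = trans (sym px≡py) ox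
    ... | px≡py | inj₁ ex with trans (sym px≡py) ex
    ... | ey with even-xy⇒even-z x y z w K eq ex ey | parity-cases w
    ...   | ez | inj₁ ew = contradiction (ex , ey , ez , ew) not-even
    ...   | ez | inj₂ ow = ex , ey , ez , ow , odd-w⇒odd-half-sum x y z w K eq ex ey ez ow

  quad-≡ : ∀ {x y z w x′ y′ z′ w′ : ℤ} → x ≡ x′ → y ≡ y′ → z ≡ z′ → w ≡ w′ → (x , y , z , w) ≡ (x′ , y′ , z′ , w′)
  quad-≡ refl refl refl refl = refl

  double halve : V → V
  double (x , y , z , w) = (+ 2 * x , + 2 * y , + 2 * z , + 2 * w)
  halve  (x , y , z , w) = (half x , half y , half z , half w)

  F-double : ∀ a d v → F a d (double v) ≡ + 4 * F a d v
  F-double a d (x , y , z , w) = identity a d x y z w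
    where
    identity : ∀ a d x y z w →
      a * ((+ 2 * x) * (+ 2 * x)) + a * ((+ 2 * y) * (+ 2 * y)) + + 2 * a * ((+ 2 * z) * (+ 2 * z)) + d * ((+ 2 * w) * (+ 2 * w))
      ≡ + 4 * (a * (x * x) + a * (y * y) + + 2 * a * (z * z) + d * (w * w))
    identity = solve-∀

  double-all-even : ∀ v → AllEven (double v)
  double-all-even (x , y , z , w) = proj₁ (even-unique x refl) , proj₁ (even-unique y refl) ,
                                    proj₁ (even-unique z refl) , proj₁ (even-unique w refl)

  halve-double : ∀ v → halve (double v) ≡ v
  halve-double (x , y , z , w) = quad-≡ (half-double x) (half-double y) (half-double z) (half-double w)

  double-halve : ∀ v → AllEven v → double (halve v) ≡ v
  double-halve (x , y , z , w) (ex , ey , ez , ew) =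
    quad-≡ (sym (even-split x ex)) (sym (even-split y ey)) (sym (even-split z ez)) (sym (even-split w ew))

  -- The substitution x ↦ 2x - 1, a bijection from ℤ onto the odd integers, turns the triangular
  -- form into the quadratic one: F(2v - 1) = 8·T(v) + 4a + d (by odd-square-tri).
  to-odd from-odd : V → V
  to-odd   (x , y , z , w) = (+ 2 * x - + 1 , + 2 * y - + 1 , + 2 * z - + 1 , + 2 * w - + 1)
  from-odd (x , y , z , w) = (half x + + 1 , half y + + 1 , half z + + 1 , half w + + 1)

  F-to-odd : ∀ a d v → F a d (to-odd v) ≡ + 8 * T a d v + (+ 4 * a + d)
  F-to-odd a d (x , y , z , w) =
    trans (F-squares a d (+ 2 * x - + 1) (+ 2 * y - + 1) (+ 2 * z - + 1) (+ 2 * w - + 1) (odd-square-tri x) (odd-square-tri y) (odd-square-tri z) (odd-square-tri w))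
          (identity a d (+ tri x) (+ tri y) (+ tri z) (+ tri w))
    where
    identity : ∀ a d X Y Z W →
      a * (+ 8 * X + + 1) + a * (+ 8 * Y + + 1) + + 2 * a * (+ 8 * Z + + 1) + d * (+ 8 * W + + 1)
      ≡ + 8 * (a * X + a * Y + + 2 * a * Z + d * W) + (+ 4 * a + d)
    identity = solve-∀

  private
    odd-shift : ∀ x → + 2 * x - + 1 ≡ + 2 * (x - + 1) + + 1
    odd-shift = solve-∀

  to-odd-all-odd : ∀ v → AllOdd (to-odd v)
  to-odd-all-odd (x , y , z , w) = odd x , odd y , odd z , odd w
    where
    odd : ∀ x → Odd (+ 2 * x - + 1)
    odd x = proj₁ (odd-unique (x - + 1) (odd-shift x))

  from-odd-to-odd : ∀ v → from-odd (to-odd v) ≡ v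
  from-odd-to-odd (x , y , z , w) = quad-≡ (inverse x) (inverse y) (inverse z) (inverse w)
    where
    cancel : ∀ x → x - + 1 + + 1 ≡ x
    cancel = solve-∀
    inverse : ∀ x → half (+ 2 * x - + 1) + + 1 ≡ x
    inverse x = trans (cong (_+ + 1) (proj₂ (odd-unique (x - + 1) (odd-shift x)))) (cancel x)

  to-odd-from-odd : ∀ v → AllOdd v → to-odd (from-odd v) ≡ v
  to-odd-from-odd (x , y , z , w) (ox , oy , oz , ow) = quad-≡ (inverse x ox) (inverse y oy) (inverse z oz) (inverse w ow)
    where
    expand : ∀ h → + 2 * (h + + 1) - + 1 ≡ + 2 * h + + 1
    expand = solve-∀
    inverse : ∀ x → Odd x → + 2 * (half x + + 1) - + 1 ≡ x
    inverse x o = trans (expand (half x)) (sym (odd-split x o))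

  sum-of-rotation : ∀ p q → (p + q) + (p - q) ≡ + 2 * p
  sum-of-rotation = solve-∀

  diff-of-rotation : ∀ p q → (p + q) - (p - q) ≡ + 2 * q
  diff-of-rotation = solve-∀

  rot unrot : V → V
  rot   (x , y , z , w) = (x + y , x - y , z , w)
  unrot (x , y , z , w) = (half (x + y) , half (x - y) , z , w)

  F-rot : ∀ a e v → F a (+ 2 * e) (rot v) ≡ + 2 * G a e v
  F-rot a e (x , y , z , w) = identity a e x y z w
    where
    identity : ∀ a e x y z w →
      a * ((x + y) * (x + y)) + a * ((x - y) * (x - y)) + + 2 * a * (z * z) + + 2 * e * (w * w)
      ≡ + 2 * (a * (x * x) + a * (y * y) + a * (z * z) + e * (w * w))
    identity = solve-∀

  unrot-rot : ∀ v → unrot (rot v) ≡ v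
  unrot-rot (x , y , z , w) =
    quad-≡ (proj₂ (even-unique x (sum-of-rotation x y))) (proj₂ (even-unique y (diff-of-rotation x y))) refl refl

  rot-unrot : ∀ x y z w → parity x ≡ parity y → rot (unrot (x , y , z , w)) ≡ (x , y , z , w)
  rot-unrot x y z w same = quad-≡ (sym (proj₁ (half-sum-diff x y same))) (sym (proj₂ (half-sum-diff x y same))) refl refl

  flip-y : V → V
  flip-y (x , y , z , w) = (x , - y , z , w)

  F-flip-y : ∀ a d v → F a d (flip-y v) ≡ F a d v
  F-flip-y a d (x , y , z , w) = cong (λ Y → a * (x * x) + a * Y + + 2 * a * (z * z) + d * (w * w)) (neg-square y)
    where
    neg-square : ∀ y → (- y) * (- y) ≡ y * y
    neg-square = solve-∀

  flip-y-involutive : ∀ v → flip-y (flip-y v) ≡ v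
  flip-y-involutive (x , y , z , w) = quad-≡ refl (ℤP.neg-involutive y) refl refl

  -- The maps φ and ψ exchange all-odd solutions with odd (x+y)/2 and the mixed solutions:
  -- with u = (x+y)/2, v = (x-y)/2 we have x = u + v, y = u - v, and F is invariant under
  -- the exchange of v and z in F(u + v, u - v, z, w).
  φ ψ : V → V
  φ (x , y , z , w) = (half (x + y) + z , half (x + y) - z , half (x - y) , w)
  ψ (x , y , z , w) = (half x + half y + z , half x + half y - z , half x - half y , w)

  F-exchange : ∀ a d u v z w → F a d (u + z , u - z , v , w) ≡ F a d (u + v , u - v , z , w)
  F-exchange a d u v z w = identity a d u v z w
    where
    identity : ∀ a d u v z w →
      a * ((u + z) * (u + z)) + a * ((u - z) * (u - z)) + + 2 * a * (v * v) + d * (w * w)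
      ≡ a * ((u + v) * (u + v)) + a * ((u - v) * (u - v)) + + 2 * a * (z * z) + d * (w * w)
    identity = solve-∀

  double-level : ∀ a d K v → F a d v ≡ + 2 * K → F a d (double v) ≡ + 8 * K × AllEven (double v)
  double-level a d K v eq = trans (F-double a d v) (trans (cong (+ 4 *_) eq) (regroup K)) , double-all-even v
    where
    regroup : ∀ K → + 4 * (+ 2 * K) ≡ + 8 * K
    regroup = solve-∀

  halve-level : ∀ a d K v → F a d v ≡ + 8 * K × AllEven v → F a d (halve v) ≡ + 2 * K
  halve-level a d K v (eq , all-even) = ℤP.*-cancelˡ-≡ (+ 4) _ _ (begin
    + 4 * F a d (halve v)      ≡⟨ F-double a d (halve v) ⟨
    F a d (double (halve v))   ≡⟨ cong (F a d) (double-halve v all-even) ⟩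
    F a d v                    ≡⟨ eq ⟩
    + 8 * K                    ≡⟨ regroup K ⟩
    + 4 * (+ 2 * K)            ∎)
    where
    regroup : ∀ K → + 8 * K ≡ + 4 * (+ 2 * K)
    regroup = solve-∀

  module OddLevel (a d n K : ℤ) (shift : + 8 * n + (+ 4 * a + d) ≡ + 8 * K) where

    to-odd-level : ∀ v → T a d v ≡ n → F a d (to-odd v) ≡ + 8 * K × AllOdd (to-odd v)
    to-odd-level v eq = trans (F-to-odd a d v) (trans (cong (λ t → + 8 * t + (+ 4 * a + d)) eq) shift) ,
                        to-odd-all-odd v

    from-odd-level : ∀ v → F a d v ≡ + 8 * K × AllOdd v → T a d (from-odd v) ≡ n
    from-odd-level v (eq , all-odd) = ℤP.*-cancelˡ-≡ (+ 8) _ _ (∙-cancelʳ (+ 4 * a + d) _ _ (begin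
      + 8 * T a d (from-odd v) + (+ 4 * a + d)  ≡⟨ F-to-odd a d (from-odd v) ⟨
      F a d (to-odd (from-odd v))               ≡⟨ cong (F a d) (to-odd-from-odd v all-odd) ⟩
      F a d v                                   ≡⟨ eq ⟩
      + 8 * K                                   ≡⟨ shift ⟨
      + 8 * n + (+ 4 * a + d)                   ∎))

  rot-level : ∀ a e L v → G a e v ≡ L → F a (+ 2 * e) (rot v) ≡ + 2 * L
  rot-level a e L v eq = trans (F-rot a e v) (cong (+ 2 *_) eq)

  rot-unrot-level : ∀ α e L v → F (A α) (+ 2 * e) v ≡ + 2 * L → rot (unrot v) ≡ v
  rot-unrot-level α e L (x , y , z , w) eq = rot-unrot x y z w (same-parity-xy α e x y z w L eq)

  unrot-level : ∀ α e L v → F (A α) (+ 2 * e) v ≡ + 2 * L → G (A α) e (unrot v) ≡ L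
  unrot-level α e L v eq = ℤP.*-cancelˡ-≡ (+ 2) _ _ (begin
    + 2 * G (A α) e (unrot v)        ≡⟨ F-rot (A α) e (unrot v) ⟨
    F (A α) (+ 2 * e) (rot (unrot v)) ≡⟨ cong (F (A α) (+ 2 * e)) (rot-unrot-level α e L v eq) ⟩
    F (A α) (+ 2 * e) v              ≡⟨ eq ⟩
    + 2 * L                          ∎)

  -- An all-odd solution
  -- is "upper" when (x+y)/2 is odd and "lower" otherwise; flip-y exchanges upper and lower
  -- solutions, and φ, ψ exchange upper and mixed ones, so #all-odd = 2·#mixed.
  module Solutions (α μ K : ℤ) where
    open Mod8 α μ

    Sol : V → Set
    Sol v = S v ≡ + 8 * K

    sol? : Decidable Sol
    sol? = level? S (+ 8 * K)

    UpperHalf : V → Set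
    UpperHalf (x , y , z , w) = Odd (half (x + y))

    upper-half? : Decidable UpperHalf
    upper-half? (x , y , z , w) = parity (half (x + y)) ℕ.≟ 1

    Upper Lower Mixed : V → Set
    Upper = (Sol ∩ AllOdd) ∩ UpperHalf
    Lower = (Sol ∩ AllOdd) ∩ ∁ UpperHalf
    Mixed = (Sol ∩ ∁ AllEven) ∩ ∁ AllOdd

    private
      other-half : ∀ x y → Odd x → Odd y → x - half (x + y) ≡ half (x - y)
      other-half x y ox oy = trans (cong (_- half (x + y)) (proj₁ (half-sum-diff x y (trans ox (sym oy)))))
                                   (cancel (half (x + y)) (half (x - y)))
        where
        cancel : ∀ u v → u + v - u ≡ v
        cancel = solve-∀

    -- Flipping y exchanges the two kinds of all-odd solutions, since (x+y)/2 + (x-y)/2 = x is odd.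
    flip-upper : ∀ v → Upper v → Lower (flip-y v)
    flip-upper (x , y , z , w) ((sol , ox , oy , oz , ow) , ou) =
      (trans (F-flip-y (A α) (+ 2 * E μ) (x , y , z , w)) sol , ox , neg-odd y oy , oz , ow) ,
      λ odd-lower → even-not-odd (half (x - y)) (subst Even (other-half x y ox oy) (odd-odd x _ ox ou)) odd-lower

    flip-lower : ∀ v → Lower v → Upper (flip-y v)
    flip-lower (x , y , z , w) ((sol , ox , oy , oz , ow) , not-ou) =
      (trans (F-flip-y (A α) (+ 2 * E μ) (x , y , z , w)) sol , ox , neg-odd y oy , oz , ow) ,
      subst Odd (other-half x y ox oy) (odd-even x _ ox (even-half-sum))
      where
      even-half-sum : Even (half (x + y))
      even-half-sum with parity-cases (half (x + y))
      ... | inj₁ e = e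
      ... | inj₂ o = contradiction o not-ou

    φ-upper : ∀ v → Upper v → Mixed (φ v)
    φ-upper (x , y , z , w) ((sol , ox , oy , oz , ow) , ou) =
      (trans (F-exchange (A α) (+ 2 * E μ) u (half (x - y)) z w)
             (trans (cong₂ (λ X Y → S (X , Y , z , w)) (sym x≡) (sym y≡)) sol) ,
       λ all-even → even-not-odd w (proj₂ (proj₂ (proj₂ all-even))) ow) ,
      λ all-odd → even-not-odd (u + z) (odd+odd u z ou oz) (proj₁ all-odd)
      where
      u : ℤ
      u = half (x + y)
      x≡ : x ≡ u + half (x - y)
      x≡ = proj₁ (half-sum-diff x y (trans ox (sym oy)))
      y≡ : y ≡ u - half (x - y)
      y≡ = proj₂ (half-sum-diff x y (trans ox (sym oy)))

    ψ-mixed : ∀ v → Mixed v → Upper (ψ v)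
    ψ-mixed (x , y , z , w) ((sol , not-even) , not-odd)
      with ex , ey , ez , ow , os ← mixed-shape x y z w K sol not-even not-odd =
      (trans (F-exchange (A α) (+ 2 * E μ) s (p - q) z w)
             (trans (cong₂ (λ X Y → S (X , Y , z , w)) (x≡ ex) (y≡ ey)) sol) ,
       odd+even s z os ez , odd-even s z os ez ,
       subst Odd (regroup p q) (odd-even s (+ 2 * q) os (proj₁ (even-unique q refl))) , ow) ,
      subst Odd (sym (proj₂ (even-unique s (sum-of-rotation s z)))) os
      where
      p q s : ℤ
      p = half x
      q = half y
      s = p + q
      regroup : ∀ p q → p + q - + 2 * q ≡ p - q
      regroup = solve-∀
      x≡ : Even x → s + (p - q) ≡ x
      x≡ ex = trans (sum-of-rotation p q) (sym (even-split x ex))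
      y≡ : Even y → s - (p - q) ≡ y
      y≡ ey = trans (diff-of-rotation p q) (sym (even-split y ey))

    ψ-φ : ∀ v → Upper v → ψ (φ v) ≡ v
    ψ-φ (x , y , z , w) ((sol , ox , oy , oz , ow) , ou) =
      quad-≡ (trans (cong (_+ v) (sym u≡)) (sym x≡)) (trans (cong (_- v) (sym u≡)) (sym y≡)) (sym z≡) refl
      where
      u v : ℤ
      u = half (x + y)
      v = half (x - y)
      x≡ : x ≡ u + v
      x≡ = proj₁ (half-sum-diff x y (trans ox (sym oy)))
      y≡ : y ≡ u - v
      y≡ = proj₂ (half-sum-diff x y (trans ox (sym oy)))
      u≡ : u ≡ half (u + z) + half (u - z)
      u≡ = proj₁ (half-sum-diff u z (trans ou (sym oz)))
      z≡ : z ≡ half (u + z) - half (u - z)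
      z≡ = proj₂ (half-sum-diff u z (trans ou (sym oz)))

    φ-ψ : ∀ v → Mixed v → φ (ψ v) ≡ v
    φ-ψ (x , y , z , w) ((sol , not-even) , not-odd)
      with ex , ey , ez , ow , os ← mixed-shape x y z w K sol not-even not-odd =
      quad-≡ (trans (cong (_+ (p - q)) half-sum) (trans (sum-of-rotation p q) (sym (even-split x ex))))
             (trans (cong (_- (p - q)) half-sum) (trans (diff-of-rotation p q) (sym (even-split y ey))))
             (proj₂ (even-unique z (diff-of-rotation s z))) refl
      where
      p q s : ℤ
      p = half x
      q = half y
      s = p + q
      half-sum : half ((s + z) + (s - z)) ≡ s
      half-sum = proj₂ (even-unique s (sum-of-rotation s z))

    upper? : Decidable Upper
    upper? = (sol? ∩? all-odd?) ∩? upper-half?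

    lower? : Decidable Lower
    lower? = (sol? ∩? all-odd?) ∩? ∁? upper-half?

    mixed? : Decidable Mixed
    mixed? = (sol? ∩? ∁? all-even?) ∩? ∁? all-odd?

    solution-count : ∀ xs →
      count sol? xs ≡ count (sol? ∩? all-even?) xs ℕ.+ (count (sol? ∩? all-odd?) xs ℕ.+ count mixed? xs)
    solution-count xs = begin
      count sol? xs
        ≡⟨ count-split sol? all-even? xs ⟩
      count (sol? ∩? all-even?) xs ℕ.+ count (sol? ∩? ∁? all-even?) xs
        ≡⟨ cong (count (sol? ∩? all-even?) xs ℕ.+_) (count-split (sol? ∩? ∁? all-even?) all-odd? xs) ⟩
      count (sol? ∩? all-even?) xs ℕ.+ (count ((sol? ∩? ∁? all-even?) ∩? all-odd?) xs ℕ.+ count mixed? xs)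
        ≡⟨ cong (λ k → count (sol? ∩? all-even?) xs ℕ.+ (k ℕ.+ count mixed? xs))
                (count-≐ ((sol? ∩? ∁? all-even?) ∩? all-odd?) (sol? ∩? all-odd?) ((λ {v} → forget {v}) , (λ {v} → remember {v})) xs) ⟩
      count (sol? ∩? all-even?) xs ℕ.+ (count (sol? ∩? all-odd?) xs ℕ.+ count mixed? xs)
        ∎
      where
      forget : ∀ {v} → ((Sol ∩ ∁ AllEven) ∩ AllOdd) v → (Sol ∩ AllOdd) v
      forget ((sol , _) , all-odd) = sol , all-odd
      remember : ∀ {v} → (Sol ∩ AllOdd) v → ((Sol ∩ ∁ AllEven) ∩ AllOdd) v
      remember {x , y , z , w} (sol , all-odd) =
        (sol , λ all-even → even-not-odd x (proj₁ all-even) (proj₁ all-odd)) , all-odd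

    all-odd-count : ∀ xs → Unique xs → (∀ v → Sol v → v ∈ xs) →
      count (sol? ∩? all-odd?) xs ≡ count mixed? xs ℕ.+ count mixed? xs
    all-odd-count xs uniq complete = begin
      count (sol? ∩? all-odd?) xs
        ≡⟨ count-split (sol? ∩? all-odd?) upper-half? xs ⟩
      count upper? xs ℕ.+ count lower? xs
        ≡⟨ cong (count upper? xs ℕ.+_) lower≡upper ⟨
      count upper? xs ℕ.+ count upper? xs
        ≡⟨ cong₂ ℕ._+_ upper≡mixed upper≡mixed ⟩
      count mixed? xs ℕ.+ count mixed? xs
        ∎
      where
      in-list : ∀ {P : V → Set} → (∀ v → P v → Sol v) → ∀ v → P v → v ∈ xs
      in-list sol-of v Pv = complete v (sol-of v Pv)
      upper≡mixed : count upper? xs ≡ count mixed? xs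
      upper≡mixed = count-bijection upper? mixed? xs xs uniq uniq φ ψ φ-upper ψ-mixed ψ-φ φ-ψ
        (in-list (λ _ p → proj₁ (proj₁ p))) (in-list (λ _ p → proj₁ (proj₁ p)))
      lower≡upper : count upper? xs ≡ count lower? xs
      lower≡upper = count-bijection upper? lower? xs xs uniq uniq flip-y flip-y flip-upper flip-lower
        (λ v _ → flip-y-involutive v) (λ v _ → flip-y-involutive v)
        (in-list (λ _ p → proj₁ (proj₁ p))) (in-list (λ _ p → proj₁ (proj₁ p)))

  three-halves : ∀ e o r → o ≡ r ℕ.+ r → + (3 ℕ.* o) ≡ + 2 * (+ (e ℕ.+ (o ℕ.+ r)) - + e)
  three-halves e o r refl
    rewrite ℤP.pos-* 3 (r ℕ.+ r) | ℤP.pos-+ e ((r ℕ.+ r) ℕ.+ r) | ℤP.pos-+ (r ℕ.+ r) r | ℤP.pos-+ r r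
    = identity (+ e) (+ r)
    where
    identity : ∀ e r → + 3 * (r + r) ≡ + 2 * ((e + ((r + r) + r)) - e)
    identity = solve-∀

  module Instance (α₀ m : ℕ) where

    a e d : ℕ
    a = suc (2 ℕ.* α₀)
    e = 4 ℕ.* m ℕ.+ 2
    d = 8 ℕ.* m ℕ.+ 4

    α μ : ℤ
    α = + α₀
    μ = + m

    Fₐ Gₐ Tₐ : V → ℤ
    Fₐ = F (A α) (+ 2 * E μ)
    Gₐ = G (A α) (E μ)
    Tₐ = T (A α) (+ 2 * E μ)

    a≡ : + a ≡ A α
    a≡ = trans (ℤP.pos-+ 1 (2 ℕ.* α₀)) (trans (cong (λ k → + 1 + k) (ℤP.pos-* 2 α₀)) (ℤP.+-comm (+ 1) (+ 2 * + α₀)))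

    2a≡ : + (2 ℕ.* a) ≡ + 2 * A α
    2a≡ = trans (ℤP.pos-* 2 a) (cong (+ 2 *_) a≡)

    e≡ : + e ≡ E μ
    e≡ = trans (ℤP.pos-+ (4 ℕ.* m) 2) (cong (_+ + 2) (ℤP.pos-* 4 m))

    d≡ : + d ≡ + 2 * E μ
    d≡ = trans (cong +_ (distribute m)) (trans (ℤP.pos-* 2 e) (cong (+ 2 *_) e≡))
      where
      distribute : ∀ m → 8 ℕ.* m ℕ.+ 4 ≡ 2 ℕ.* (4 ℕ.* m ℕ.+ 2)
      distribute = ℕ-Solver.solve-∀

    1≤d : 1 ≤ d
    1≤d = ℕP.≤-trans (s≤s z≤n) (ℕP.m≤n+m 4 (8 ℕ.* m))

    1≤e : 1 ≤ e
    1≤e = ℕP.≤-trans (s≤s z≤n) (ℕP.m≤n+m 2 (4 ℕ.* m))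

    private
      module ReadF = Reading sq square sq-as-square sq-bound a≡ a≡ 2a≡ d≡ (s≤s z≤n) (s≤s z≤n) (s≤s z≤n) 1≤d
      module ReadG = Reading sq square sq-as-square sq-bound a≡ a≡ a≡ e≡ (s≤s z≤n) (s≤s z≤n) (s≤s z≤n) 1≤e
      module ReadT = Reading tri (λ x → + tri x) (λ _ → refl) (λ x → proj₂ (tri-spec x))
                             a≡ a≡ 2a≡ d≡ (s≤s z≤n) (s≤s z≤n) (s≤s z≤n) 1≤d

    N-rotation : ∀ L → N a a a e L ≡ N a a (2 ℕ.* a) d (2 ℕ.* L)
    N-rotation L = begin
      N a a a e L
        ≡⟨ ReadG.count-as-level L ⟩
      count (level? Gₐ (+ L)) (box (suc L))
        ≡⟨ count-bijection (level? Gₐ (+ L)) (level? Fₐ (+ 2 * + L)) (box (suc L)) (box (suc (2 ℕ.* L)))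
             (box-unique (suc L)) (box-unique (suc (2 ℕ.* L)))
             rot unrot (rot-level (A α) (E μ) (+ L)) (unrot-level α (E μ) (+ L)) (λ v _ → unrot-rot v) (rot-unrot-level α (E μ) (+ L))
             (ReadG.level-in-box L) (λ v eq → ReadF.level-in-box (2 ℕ.* L) v (trans eq (sym 2L≡))) ⟩
      count (level? Fₐ (+ 2 * + L)) (box (suc (2 ℕ.* L)))
        ≡⟨ cong (λ c → count (level? Fₐ c) (box (suc (2 ℕ.* L)))) 2L≡ ⟨
      count (level? Fₐ (+ (2 ℕ.* L))) (box (suc (2 ℕ.* L)))
        ≡⟨ ReadF.count-as-level (2 ℕ.* L) ⟨
      N a a (2 ℕ.* a) d (2 ℕ.* L)
        ∎
      where
      2L≡ : + (2 ℕ.* L) ≡ + 2 * + L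
      2L≡ = ℤP.pos-* 2 L

    -- K = n + m + (a + 1)/2, so that 8K = 8n + 4a + d.
    K : ℕ → ℕ
    K n = n ℕ.+ m ℕ.+ α₀ ℕ.+ 1

    module _ (n : ℕ) where
      open Solutions α μ (+ K n)

      B : List V
      B = box (suc (8 ℕ.* K n))

      B-unique : Unique B
      B-unique = box-unique (suc (8 ℕ.* K n))

      8K≡ : + (8 ℕ.* K n) ≡ + 8 * + K n
      8K≡ = ℤP.pos-* 8 (K n)

      sol-in-B : ∀ v → Sol v → v ∈ B
      sol-in-B v sol = ReadF.level-in-box (8 ℕ.* K n) v (trans sol (sym 8K≡))

      -- 8n + 4a + d = 8K, the shift produced by the substitution x ↦ 2x - 1.
      shift : + 8 * + n + (+ 4 * A α + + 2 * E μ) ≡ + 8 * + K n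
      shift = trans (identity (+ n) μ α) (cong (+ 8 *_) (sym K≡))
        where
        identity : ∀ n μ α → + 8 * n + (+ 4 * (+ 2 * α + + 1) + + 2 * (+ 4 * μ + + 2)) ≡ + 8 * (n + μ + α + + 1)
        identity = solve-∀
        K≡ : + K n ≡ + n + μ + α + + 1
        K≡ = trans (ℤP.pos-+ (n ℕ.+ m ℕ.+ α₀) 1)
                   (cong (_+ + 1) (trans (ℤP.pos-+ (n ℕ.+ m) α₀) (cong (_+ α) (ℤP.pos-+ n m))))

      t-as-all-odd : t a a (2 ℕ.* a) d n ≡ count (sol? ∩? all-odd?) B
      t-as-all-odd = begin
        t a a (2 ℕ.* a) d n                      ≡⟨ ReadT.count-as-level n ⟩
        count (level? Tₐ (+ n)) (box (suc n))
          ≡⟨ count-bijection (level? Tₐ (+ n)) (sol? ∩? all-odd?) (box (suc n)) B (box-unique (suc n)) B-unique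
               to-odd from-odd to-odd-level from-odd-level (λ v _ → from-odd-to-odd v) (λ v p → to-odd-from-odd v (proj₂ p))
               (ReadT.level-in-box n) (λ v p → sol-in-B v (proj₁ p)) ⟩
        count (sol? ∩? all-odd?) B               ∎
        where
        open OddLevel (A α) (+ 2 * E μ) (+ n) (+ K n) shift

      N2K-as-all-even : N a a (2 ℕ.* a) d (2 ℕ.* K n) ≡ count (sol? ∩? all-even?) B
      N2K-as-all-even = begin
        N a a (2 ℕ.* a) d (2 ℕ.* K n)
          ≡⟨ ReadF.count-as-level (2 ℕ.* K n) ⟩
        count (level? Fₐ (+ (2 ℕ.* K n))) (box (suc (2 ℕ.* K n)))
          ≡⟨ cong (λ c → count (level? Fₐ c) (box (suc (2 ℕ.* K n)))) 2K≡ ⟩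
        count (level? Fₐ (+ 2 * + K n)) (box (suc (2 ℕ.* K n)))
          ≡⟨ count-bijection (level? Fₐ (+ 2 * + K n)) (sol? ∩? all-even?) (box (suc (2 ℕ.* K n))) B
               (box-unique (suc (2 ℕ.* K n))) B-unique double halve (double-level (A α) (+ 2 * E μ) (+ K n))
               (halve-level (A α) (+ 2 * E μ) (+ K n)) (λ v _ → halve-double v) (λ v p → double-halve v (proj₂ p))
               (λ v eq → ReadF.level-in-box (2 ℕ.* K n) v (trans eq (sym 2K≡))) (λ v p → sol-in-B v (proj₁ p)) ⟩
        count (sol? ∩? all-even?) B
          ∎
        where
        2K≡ : + (2 ℕ.* K n) ≡ + 2 * + K n
        2K≡ = ℤP.pos-* 2 (K n)

      N8K-as-solutions : N a a (2 ℕ.* a) d (8 ℕ.* K n) ≡ count sol? B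
      N8K-as-solutions = trans (ReadF.count-as-level (8 ℕ.* K n)) (cong (λ c → count (level? Fₐ c) B) 8K≡)

      t-formula : + (3 ℕ.* t a a (2 ℕ.* a) d n)
                ≡ + 2 * (+ N a a (2 ℕ.* a) d (8 ℕ.* K n) - + N a a (2 ℕ.* a) d (2 ℕ.* K n))
      t-formula = begin
        + (3 ℕ.* t a a (2 ℕ.* a) d n)
          ≡⟨ cong (λ k → + (3 ℕ.* k)) t-as-all-odd ⟩
        + (3 ℕ.* count (sol? ∩? all-odd?) B)
          ≡⟨ three-halves (count (sol? ∩? all-even?) B) _ _ (all-odd-count B B-unique sol-in-B) ⟩
        + 2 * (+ (count (sol? ∩? all-even?) B ℕ.+ (count (sol? ∩? all-odd?) B ℕ.+ count mixed? B))
               - + count (sol? ∩? all-even?) B)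
          ≡⟨ cong₂ (λ M₈ M₂ → + 2 * (+ M₈ - + M₂)) (trans (sym (solution-count B)) (sym N8K-as-solutions))
                                                  (sym N2K-as-all-even) ⟩
        + 2 * (+ N a a (2 ℕ.* a) d (8 ℕ.* K n) - + N a a (2 ℕ.* a) d (2 ℕ.* K n))
          ∎

      8K-index : 8 ℕ.* n ℕ.+ 8 ℕ.* m ℕ.+ 4 ℕ.* a ℕ.+ 4 ≡ 8 ℕ.* K n
      8K-index = identity n m α₀
        where
        identity : ∀ n m α → 8 ℕ.* n ℕ.+ 8 ℕ.* m ℕ.+ 4 ℕ.* suc (2 ℕ.* α) ℕ.+ 4 ≡ 8 ℕ.* (n ℕ.+ m ℕ.+ α ℕ.+ 1)
        identity = ℕ-Solver.solve-∀

      2K-index : 2 ℕ.* n ℕ.+ 2 ℕ.* m ℕ.+ a ℕ.+ 1 ≡ 2 ℕ.* K n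
      2K-index = identity n m α₀
        where
        identity : ∀ n m α → 2 ℕ.* n ℕ.+ 2 ℕ.* m ℕ.+ suc (2 ℕ.* α) ℕ.+ 1 ≡ 2 ℕ.* (n ℕ.+ m ℕ.+ α ℕ.+ 1)
        identity = ℕ-Solver.solve-∀

      4K-index : 2 ℕ.* (4 ℕ.* n ℕ.+ 4 ℕ.* m ℕ.+ 2 ℕ.* a ℕ.+ 2) ≡ 8 ℕ.* K n
      4K-index = identity n m α₀
        where
        identity : ∀ n m α → 2 ℕ.* (4 ℕ.* n ℕ.+ 4 ℕ.* m ℕ.+ 2 ℕ.* suc (2 ℕ.* α) ℕ.+ 2) ≡ 8 ℕ.* (n ℕ.+ m ℕ.+ α ℕ.+ 1)
        identity = ℕ-Solver.solve-∀

      K-index : n ℕ.+ m ℕ.+ (a ℕ.+ 1) ℕ./ 2 ≡ K n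
      K-index = trans (cong (λ k → n ℕ.+ m ℕ.+ k) half-a+1) (regroup n m α₀)
        where
        as-product : ∀ α → suc (2 ℕ.* α) ℕ.+ 1 ≡ suc α ℕ.* 2
        as-product = ℕ-Solver.solve-∀
        half-a+1 : (a ℕ.+ 1) ℕ./ 2 ≡ suc α₀
        half-a+1 = trans (cong (ℕ._/ 2) (as-product α₀)) (m*n/n≡m (suc α₀) 2)
        regroup : ∀ n m α → n ℕ.+ m ℕ.+ suc α ≡ n ℕ.+ m ℕ.+ α ℕ.+ 1
        regroup = ℕ-Solver.solve-∀

      theorem-F : + (3 ℕ.* t a a (2 ℕ.* a) d n)
        ≡ + 2 * (+ N a a (2 ℕ.* a) d (8 ℕ.* n ℕ.+ 8 ℕ.* m ℕ.+ 4 ℕ.* a ℕ.+ 4) - + N a a (2 ℕ.* a) d (2 ℕ.* n ℕ.+ 2 ℕ.* m ℕ.+ a ℕ.+ 1))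
      theorem-F = trans t-formula (cong₂ (λ i j → + 2 * (+ N a a (2 ℕ.* a) d i - + N a a (2 ℕ.* a) d j))
                                         (sym 8K-index) (sym 2K-index))

      theorem-G : + (3 ℕ.* t a a (2 ℕ.* a) d n)
        ≡ + 2 * (+ N a a a e (4 ℕ.* n ℕ.+ 4 ℕ.* m ℕ.+ 2 ℕ.* a ℕ.+ 2) - + N a a a e (n ℕ.+ m ℕ.+ (a ℕ.+ 1) ℕ./ 2))
      theorem-G = trans t-formula (cong₂ (λ M₈ M₂ → + 2 * (+ M₈ - + M₂))
        (sym (trans (N-rotation (4 ℕ.* n ℕ.+ 4 ℕ.* m ℕ.+ 2 ℕ.* a ℕ.+ 2)) (cong (N a a (2 ℕ.* a) d) 4K-index)))
        (sym (trans (cong (N a a a e) K-index) (N-rotation (K n)))))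

  odd-form : ∀ a → a ℕ.% 2 ≡ 1 → ∃ λ α₀ → a ≡ suc (2 ℕ.* α₀)
  odd-form a a%2≡1 = a ℕ./ 2 , trans (m≡m%n+[m/n]*n a 2) (trans (cong (ℕ._+ a ℕ./ 2 ℕ.* 2) a%2≡1) (cong suc (ℕP.*-comm (a ℕ./ 2) 2)))

open Proof using (odd-form; module Instance)
open import Data.Nat using (ℕ; _+_; _*_; _/_; _%_; _≥_)
open import Data.Integer using (ℤ; +_; _-_)
open import Data.Product using (_×_; _,_)
open import Relation.Binary.PropositionalEquality using (_≡_; refl)

-- Write a = 2α + 1; both identities are then Instance.theorem-G and Instance.theorem-F.
theorem2p1 : (a m n : ℕ) → a % 2 ≡ 1 → n ≥ 1 →
    (+ (3 * t a a (2 * a) (8 * m + 4) n)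
      ≡ + 2 Data.Integer.* (+ N a a a (4 * m + 2) (4 * n + 4 * m + 2 * a + 2)
                            - + N a a a (4 * m + 2) (n + m + (a + 1) / 2)))
    × (+ (3 * t a a (2 * a) (8 * m + 4) n)
      ≡ + 2 Data.Integer.* (+ N a a (2 * a) (8 * m + 4) (8 * n + 8 * m + 4 * a + 4)
                            - + N a a (2 * a) (8 * m + 4) (2 * n + 2 * m + a + 1)))
theorem2p1 a m n a-odd _ with odd-form a a-odd
... | α₀ , refl = Instance.theorem-G α₀ m n , Instance.theorem-F α₀ m n
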